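{- Let $\sigma$ be any argumentation semantics and let $\mathcal V=(V_a)_{a\in\mathcal A}$ be any basis. Then for all arguments $p,q\in\Pi$ and every formula $\phi$ of the language $\mathcal L$, each of the following formulas is true at every point of the deliberative Kripke model $K^\sigma_{\mathcal V}$: 1. $\langle p\rangle\langle q\rangle\phi\leftrightarrow\langle q\rangle\langle p\rangle\phi$; 2. $\langle p\rangle[q]\phi\to[q]\langle p\rangle\phi$; 3. $\Diamond\Box\phi\to\Box\Diamond\phi$; 4. $\langle p\rangle\langle p\rangle\phi\to\langle p\rangle\phi$.
   Context: An argumentation framework (AF) is a digraph $(S,E)$ with $E\subseteq S\times S$; $(x,y)\in E$ means $x$ attacks $y$. An argumentation semantics $\sigma$ assigns to each AF $(S,E)$ a set $\sigma(S,E)\subseteq 2^S$ of "extensions". Fix a finite nonempty set $\mathcal A$ of agents and a countably infinite set $\Pi$ of arguments. A basis is a family $\mathcal V=(V_a)_{a\in\mathcal A}$ with each $V_a\subseteq\Pi\times\Pi$. For $T\subseteq\Pi$ write $V_a|_T=V_a\cap(T\times T)$. The deliberative Kripke model $K^\sigma_{\mathcal V}=(C_{\mathcal V},R_{\mathcal V},\pi_\sigma)$ is: $C_{\mathcal V}$ is the set of pairs $q=(q_S,q_E)$ with $q_S\subseteq\Pi$ and $\bigcap_{a}V_a|_{q_S}\subseteq q_E\subseteq\bigcup_a V_a|_{q_S}$. For $p\in\Pi$ and $q\in C_{\mathcal V}$ let $U(q,p)=\{X\mid \bigcap_a V_a|_{q_S\cup\{p\}}\subseteq X\subseteq\bigcup_aV_a|_{q_S\cup\{p\}}\}$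 and $succ(p,q)=\{(q_S\cup\{p\},q_E\cup X)\mid X\in U(q,p)\}$, $succ(q)=\bigcup_{p\in\Pi}succ(p,q)$. Relations: $R_{\mathcal V}(p)=\{(q,q')\mid q'\in succ(p,q)\}$ for $p\in\Pi$, and $R_{\mathcal V}(\exists)=\{(q,q')\mid q'\in succ(q)\}$. Labellings: $\pi_\sigma(q)$ is the set of three-partitions $\pi=(\pi_1,\pi_0,\pi_{1/2})$ of $\Pi$ with $\pi_1\in\sigma(q_S,q_E)$, $\pi_0=\{p\in q_S\mid\exists r\in\pi_1:(r,p)\in q_E\}$, and $\pi_{1/2}=\Pi\setminus(\pi_1\cup\pi_0)$. Language: inner formulas $\alpha::=p\mid\neg\alpha\mid\alpha\to\alpha$ ($p\in\Pi$), evaluated by Łukasiewicz three-valued logic: $\bar\pi(p)=x$ iff $p\in\pi_x$, $\bar\pi(\neg\alpha)=1-\bar\pi(\alpha)$, $\bar\pi(\alpha_1\to\alpha_2)=\min\{1,1-(\bar\pi(\alpha_1)-\bar\pi(\alpha_2))\}$. Outer formulas $\phi::=\langle c\rangle\alpha\mid\neg\phi\mid\phi\wedge\phi\mid\langle p\rangle\phi\mid\Diamond\phi$ ($p\in\Pi$); $\mathcal L$ is the set of these. Truth at $q\in C_{\mathcal V}$: $q\models\langle c\rangle\alpha$ iff some $\pi\in\pi_\sigma(q)$ has $\bar\pi(\alpha)=1$; Boolean connectives as usual; $q\models\langle p\rangle\phi$ iff some $q'$ with $(q,q')\in R_{\mathcal V}(p)$ has $q'\models\phi$; $q\models\Diamond\phi$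 iff some $q'$ with $(q,q')\in R_{\mathcal V}(\exists)$ has $q'\models\phi$. Abbreviations: $[p]\phi=\neg\langle p\rangle\neg\phi$, $\Box\phi=\neg\Diamond\neg\phi$; $\to,\leftrightarrow$ between outer formulas are the classical ones. -}

module Defs where

open import Data.Nat using (ℕ)
open import Data.Fin using (Fin)
open import Data.Product using (Σ; ∃; _×_; _,_)
open import Data.Sum using (_⊎_)
open import Relation.Binary.PropositionalEquality using (_≡_)
open import Relation.Nullary using (¬_)
open import Level using (Level; _⊔_) renaming (suc to lsuc; zero to lzero)

Arg : Set
Arg = ℕ

SetΠ : Set₁
SetΠ = Arg → Set

RelΠ : Set₁
RelΠ = Arg → Arg → Set

_≐_ : SetΠ → SetΠ → Set
A ≐ B = ∀ x → (A x → B x) × (B x → A x)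

_≐₂_ : RelΠ → RelΠ → Set
A ≐₂ B = ∀ x y → (A x y → B x y) × (B x y → A x y)

_⊆₂_ : RelΠ → RelΠ → Set
A ⊆₂ B = ∀ x y → A x y → B x y

_∪₂_ : RelΠ → RelΠ → RelΠ
(A ∪₂ B) x y = A x y ⊎ B x y

_∪｛_｝ : SetΠ → Arg → SetΠ
(T ∪｛ p ｝) x = T x ⊎ x ≡ p

-- An argumentation semantics: for each AF (S,E) a set of extensions ⊆ 2^S.
Semantics : Set₁
Semantics = SetΠ → RelΠ → SetΠ → Set

-- Agents: a finite nonempty set, Fin (suc k).  A basis: V a ⊆ Π × Π.
Basis : ℕ → Set₁
Basis k = Fin (Data.Nat.suc k) → RelΠ

module Model {k : ℕ} (V : Basis k) (σ : Semantics) where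

  Agent : Set
  Agent = Fin (Data.Nat.suc k)

  restrict : Agent → SetΠ → RelΠ
  restrict a T x y = V a x y × T x × T y

  ⋂V : SetΠ → RelΠ
  ⋂V T x y = ∀ a → restrict a T x y

  ⋃V : SetΠ → RelΠ
  ⋃V T x y = ∃ λ a → restrict a T x y

  record Point : Set₁ where
    constructor point
    field
      S  : SetΠ
      E  : RelΠ
      lo : ⋂V S ⊆₂ E
      hi : E ⊆₂ ⋃V S
  open Point public

  InU : Point → Arg → RelΠ → Set
  InU q p X = (⋂V (S q ∪｛ p ｝) ⊆₂ X) × (X ⊆₂ ⋃V (S q ∪｛ p ｝))

  Rp : Arg → Point → Point → Set₁
  Rp p q q' = (S q' ≐ (S q ∪｛ p ｝)) ×
              (Σ RelΠ λ X → InU q p X × (E q' ≐₂ (E q ∪₂ X)))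

  R∃ : Point → Point → Set₁
  R∃ q q' = Σ Arg λ p → Rp p q q'

  -- Three truth values 0, 1/2, 1 of Łukasiewicz logic.
  data V3 : Set where
    v0 v½ v1 : V3

  neg3 : V3 → V3
  neg3 v0 = v1
  neg3 v½ = v½
  neg3 v1 = v0

  -- min{1, 1 - (a - b)}
  imp3 : V3 → V3 → V3
  imp3 v0 _  = v1
  imp3 v½ v0 = v½
  imp3 v½ v½ = v1
  imp3 v½ v1 = v1
  imp3 v1 b  = b

  data Inner : Set where
    var  : Arg → Inner
    ¬ᵢ_  : Inner → Inner
    _⇒ᵢ_ : Inner → Inner → Inner

  -- A labelling π is represented by its valuation π̄ : Π → {0,1/2,1}
  -- (π_x = π̄⁻¹(x); this is exactly a three-partition of Π).
  eval : (Arg → V3) → Inner → V3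
  eval l (var p)   = l p
  eval l (¬ᵢ a)    = neg3 (eval l a)
  eval l (a ⇒ᵢ b)  = imp3 (eval l a) (eval l b)

  IsLabelling : Point → (Arg → V3) → Set
  IsLabelling q l =
    σ (S q) (E q) (λ x → l x ≡ v1) ×
    (∀ x → ((l x ≡ v0) → (S q x × ∃ λ r → l r ≡ v1 × E q r x)) ×
           ((S q x × ∃ λ r → l r ≡ v1 × E q r x) → l x ≡ v0))

  data Formula : Set where
    ⟨c⟩_ : Inner → Formula
    ¬ₒ_  : Formula → Formula
    _∧ₒ_ : Formula → Formula → Formula
    ⟨_⟩_ : Arg → Formula → Formula
    ◇_   : Formula → Formula

  _⊨_ : Point → Formula → Set₁
  q ⊨ (⟨c⟩ α)   = Level.Lift _ (∃ λ l → IsLabelling q l × eval l α ≡ v1)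
  q ⊨ (¬ₒ φ)    = ¬ (q ⊨ φ)
  q ⊨ (φ ∧ₒ ψ)  = (q ⊨ φ) × (q ⊨ ψ)
  q ⊨ (⟨ p ⟩ φ) = Σ Point λ q' → Rp p q q' × (q' ⊨ φ)
  q ⊨ (◇ φ)     = Σ Point λ q' → R∃ q q' × (q' ⊨ φ)

  [_]_ : Arg → Formula → Formula
  [ p ] φ = ¬ₒ (⟨ p ⟩ (¬ₒ φ))

  □_ : Formula → Formula
  □ φ = ¬ₒ (◇ (¬ₒ φ))

  _⟶_ : Formula → Formula → Formula
  φ ⟶ ψ = ¬ₒ (φ ∧ₒ (¬ₒ ψ))

  _⟷_ : Formula → Formula → Formula
  φ ⟷ ψ = (φ ⟶ ψ) ∧ₒ (ψ ⟶ φ)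

module Submission where

-- The proof never inspects the labellings: all four validities are frame
-- properties of the relations R(p) and R(∃).  The key observation is a
-- characterisation of a single step (`step-intro` / `step-elim`):
--
--     w →ₚ w'   iff   S w' = S w ∪ {p}   and   E w ⊆ E w',
--
-- because any point w' already satisfies ⋂V(S w') ⊆ E w' ⊆ ⋃V(S w'), so
-- X := E w' is an admissible choice from U(w,p).  Common successors are then
-- built by `closure T R`, the least point over argument set T whose attack
-- relation contains R.

open import Defs
open import Data.Nat using (ℕ)
open import Data.Fin using (zero)
open import Data.Product using (Σ; _×_; _,_; proj₁; proj₂)
open import Data.Sum using (inj₁; inj₂)

_⊆_ : SetΠ → SetΠ → Set
A ⊆ B = ∀ x → A x → B x

≐-refl : {A : SetΠ} → A ≐ A
≐-refl x = (λ h → h) , (λ h → h)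

≐-sym : {A B : SetΠ} → A ≐ B → B ≐ A
≐-sym A≐B x = proj₂ (A≐B x) , proj₁ (A≐B x)

≐-trans : {A B C : SetΠ} → A ≐ B → B ≐ C → A ≐ C
≐-trans A≐B B≐C x =
  (λ h → proj₁ (B≐C x) (proj₁ (A≐B x) h)) , (λ h → proj₂ (A≐B x) (proj₂ (B≐C x) h))

≐⇒⊆ : {A B : SetΠ} → A ≐ B → A ⊆ B
≐⇒⊆ A≐B x = proj₁ (A≐B x)

≐⇒⊇ : {A B : SetΠ} → A ≐ B → B ⊆ A
≐⇒⊇ A≐B x = proj₂ (A≐B x)

∪-inl : (A : SetΠ) (p : Arg) → A ⊆ (A ∪｛ p ｝)
∪-inl A p x = inj₁

∪-mono : {A B : SetΠ} (p : Arg) → A ⊆ B → (A ∪｛ p ｝) ⊆ (B ∪｛ p ｝)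
∪-mono p A⊆B x (inj₁ h) = inj₁ (A⊆B x h)
∪-mono p A⊆B x (inj₂ e) = inj₂ e

∪-cong : {A B : SetΠ} (p : Arg) → A ≐ B → (A ∪｛ p ｝) ≐ (B ∪｛ p ｝)
∪-cong p A≐B x = ∪-mono p (≐⇒⊆ A≐B) x , ∪-mono p (≐⇒⊇ A≐B) x

∪-swap : (A : SetΠ) (p q : Arg) → ((A ∪｛ p ｝) ∪｛ q ｝) ⊆ ((A ∪｛ q ｝) ∪｛ p ｝)
∪-swap A p q x (inj₁ (inj₁ h)) = inj₁ (inj₁ h)
∪-swap A p q x (inj₁ (inj₂ e)) = inj₂ e
∪-swap A p q x (inj₂ e)        = inj₁ (inj₂ e)

∪-comm : (A : SetΠ) (p q : Arg) → ((A ∪｛ p ｝) ∪｛ q ｝) ≐ ((A ∪｛ q ｝) ∪｛ p ｝)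
∪-comm A p q x = ∪-swap A p q x , ∪-swap A q p x

∪-idem : (A : SetΠ) (p : Arg) → ((A ∪｛ p ｝) ∪｛ p ｝) ≐ (A ∪｛ p ｝)
∪-idem A p x = (λ { (inj₁ h) → h ; (inj₂ e) → inj₂ e }) , inj₁

module Frame {k : ℕ} (V : Basis k) (σ : Semantics) where
  open Model V σ

  -- Both bounds on attack relations are monotone in the argument set, and the
  -- lower bound lies below the upper one because there is at least one agent.

  ⋂V-mono : {T T' : SetΠ} → T ⊆ T' → ⋂V T ⊆₂ ⋂V T'
  ⋂V-mono T⊆T' x y h a = let (v , tx , ty) = h a in v , T⊆T' x tx , T⊆T' y ty

  ⋃V-mono : {T T' : SetΠ} → T ⊆ T' → ⋃V T ⊆₂ ⋃V T'
  ⋃V-mono T⊆T' x y (a , v , tx , ty) = a , v , T⊆T' x tx , T⊆T' y ty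

  ⋂V⊆⋃V : (T : SetΠ) → ⋂V T ⊆₂ ⋃V T
  ⋂V⊆⋃V T x y h = zero , h zero

  E⊆⋃V : (w : Point) {T : SetΠ} → S w ⊆ T → E w ⊆₂ ⋃V T
  E⊆⋃V w S⊆T x y h = ⋃V-mono S⊆T x y (hi w x y h)

  step-elim : {p : Arg} {w w' : Point} → Rp p w w' →
              (S w' ≐ (S w ∪｛ p ｝)) × (E w ⊆₂ E w')
  step-elim (S≐ , _ , _ , E≐) = S≐ , λ x y h → proj₂ (E≐ x y) (inj₁ h)

  -- Conversely these two conditions suffice: X := E w' is in U(w,p), since
  -- the bounds ⋂V and ⋃V of w' are taken over S w' = S w ∪ {p}.
  step-intro : {p : Arg} {w w' : Point} →
               S w' ≐ (S w ∪｛ p ｝) → E w ⊆₂ E w' → Rp p w w'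
  step-intro {w' = w'} S≐ E⊆ =
    S≐ , E w' ,
    ((λ x y h → lo w' x y (⋂V-mono (≐⇒⊇ S≐) x y h)) ,
     (λ x y h → ⋃V-mono (≐⇒⊆ S≐) x y (hi w' x y h))) ,
    λ x y → inj₂ , λ { (inj₁ h) → E⊆ x y h ; (inj₂ h) → h }

  closure : (T : SetΠ) (R : RelΠ) → R ⊆₂ ⋃V T → Point
  closure T R R⊆⋃V =
    point T (R ∪₂ ⋂V T) (λ x y → inj₂)
      (λ { x y (inj₁ h) → R⊆⋃V x y h ; x y (inj₂ h) → ⋂V⊆⋃V T x y h })

  closure-least : {T : SetΠ} {R : RelΠ} (R⊆⋃V : R ⊆₂ ⋃V T) (w : Point) →
                  T ⊆ S w → R ⊆₂ E w → E (closure T R R⊆⋃V) ⊆₂ E w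
  closure-least R⊆⋃V w T⊆S R⊆E x y (inj₁ h) = R⊆E x y h
  closure-least R⊆⋃V w T⊆S R⊆E x y (inj₂ h) = lo w x y (⋂V-mono T⊆S x y h)

  two-steps : {p q : Arg} {w v u : Point} → Rp p w v → Rp q v u →
              (S u ≐ ((S w ∪｛ p ｝) ∪｛ q ｝)) × (E w ⊆₂ E u)
  two-steps {p} {q} {w} {v} {u} w→v v→u =
    let (Sv≐ , Ew⊆Ev) = step-elim {p} {w} {v} w→v
        (Su≐ , Ev⊆Eu) = step-elim {q} {v} {u} v→u
    in ≐-trans Su≐ (∪-cong q Sv≐) , λ x y h → Ev⊆Eu x y (Ew⊆Ev x y h)

  step-idem : {p : Arg} {w v u : Point} → Rp p w v → Rp p v u → Rp p w u
  step-idem {p} {w} {v} {u} w→v v→u =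
    let (Su≐ , Ew⊆Eu) = two-steps {p} {p} {w} {v} {u} w→v v→u
    in step-intro {p} {w} {u} (≐-trans Su≐ (∪-idem (S w) p)) Ew⊆Eu

  step-swap : {p q : Arg} {w v u : Point} → Rp p w v → Rp q v u →
              Σ Point λ v' → Rp q w v' × Rp p v' u
  step-swap {p} {q} {w} {v} {u} w→v v→u =
    v' , step-intro {q} {w} {v'} ≐-refl (λ x y → inj₁) ,
    step-intro {p} {v'} {u} Su≐ (closure-least Ew⊆⋃V u (λ x h → ≐⇒⊇ Su≐ x (inj₁ h)) Ew⊆Eu)
    where
    Ew⊆⋃V : E w ⊆₂ ⋃V (S w ∪｛ q ｝)
    Ew⊆⋃V = E⊆⋃V w (∪-inl (S w) q)
    v' : Point
    v' = closure (S w ∪｛ q ｝) (E w) Ew⊆⋃V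
    Su≐ : S u ≐ ((S w ∪｛ q ｝) ∪｛ p ｝)
    Su≐ = ≐-trans (proj₁ (two-steps {p} {q} {w} {v} {u} w→v v→u)) (∪-comm (S w) p q)
    Ew⊆Eu : E w ⊆₂ E u
    Ew⊆Eu = proj₂ (two-steps {p} {q} {w} {v} {u} w→v v→u)

  step-diamond : {p q : Arg} {w v v' : Point} → Rp p w v → Rp q w v' →
                 Σ Point λ u → Rp q v u × Rp p v' u
  step-diamond {p} {q} {w} {v} {v'} w→v w→v' =
    u , step-intro {q} {v} {u} (∪-cong q (≐-sym Sv≐)) (λ x y h → inj₁ (inj₁ h)) ,
        step-intro {p} {v'} {u} Su≐ (λ x y h → inj₁ (inj₂ h))
    where
    Sv≐ : S v ≐ (S w ∪｛ p ｝)
    Sv≐ = proj₁ (step-elim {p} {w} {v} w→v)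
    Su≐ : ((S w ∪｛ p ｝) ∪｛ q ｝) ≐ (S v' ∪｛ p ｝)
    Su≐ = ≐-trans (∪-comm (S w) p q) (∪-cong p (≐-sym (proj₁ (step-elim {q} {w} {v'} w→v'))))
    bound : (E v ∪₂ E v') ⊆₂ ⋃V ((S w ∪｛ p ｝) ∪｛ q ｝)
    bound x y (inj₁ h) = E⊆⋃V v (λ x h → inj₁ (≐⇒⊆ Sv≐ x h)) x y h
    bound x y (inj₂ h) = E⊆⋃V v' (λ x h → ≐⇒⊇ Su≐ x (inj₁ h)) x y h
    u : Point
    u = closure ((S w ∪｛ p ｝) ∪｛ q ｝) (E v ∪₂ E v') bound

  some-step-diamond : {w v v' : Point} → R∃ w v → R∃ w v' →
                      Σ Point λ u → R∃ v u × R∃ v' u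
  some-step-diamond {w} {v} {v'} (p , w→v) (q , w→v') =
    let (u , v→u , v'→u) = step-diamond {p} {q} {w} {v} {v'} w→v w→v'
    in u , (q , v→u) , (p , v'→u)

  commutation-valid : (p q : Arg) (φ : Formula) (w : Point) →
                      w ⊨ ((⟨ p ⟩ (⟨ q ⟩ φ)) ⟶ (⟨ q ⟩ (⟨ p ⟩ φ)))
  commutation-valid p q φ w ((v , w→v , u , v→u , u⊨φ) , ¬goal) =
    let (v' , w→v' , v'→u) = step-swap {p} {q} {w} {v} {u} w→v v→u
    in ¬goal (v' , w→v' , u , v'→u , u⊨φ)

  church-rosser-valid : (p q : Arg) (φ : Formula) (w : Point) →
                        w ⊨ ((⟨ p ⟩ ([ q ] φ)) ⟶ ([ q ] (⟨ p ⟩ φ)))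
  church-rosser-valid p q φ w ((v , w→v , v⊨[q]φ) , ¬goal) =
    ¬goal λ (v' , w→v' , v'⊭⟨p⟩φ) →
      let (u , v→u , v'→u) = step-diamond {p} {q} {w} {v} {v'} w→v w→v'
      in v⊨[q]φ (u , v→u , λ u⊨φ → v'⊭⟨p⟩φ (u , v'→u , u⊨φ))

  confluence-valid : (φ : Formula) (w : Point) → w ⊨ ((◇ (□ φ)) ⟶ (□ (◇ φ)))
  confluence-valid φ w ((v , w→v , v⊨□φ) , ¬goal) =
    ¬goal λ (v' , w→v' , v'⊭◇φ) →
      let (u , v→u , v'→u) = some-step-diamond {w} {v} {v'} w→v w→v'
      in v⊨□φ (u , v→u , λ u⊨φ → v'⊭◇φ (u , v'→u , u⊨φ))

  idempotence-valid : (p : Arg) (φ : Formula) (w : Point) →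
                      w ⊨ ((⟨ p ⟩ (⟨ p ⟩ φ)) ⟶ (⟨ p ⟩ φ))
  idempotence-valid p φ w ((v , w→v , u , v→u , u⊨φ) , ¬goal) =
    ¬goal (u , step-idem {p} {w} {v} {u} w→v v→u , u⊨φ)

proposition1 : (k : ℕ) (V : Basis k) (σ : Semantics) →
    let open Model V σ in
    (p q : Arg) (φ : Formula) (w : Point) →
      (w ⊨ ((⟨ p ⟩ (⟨ q ⟩ φ)) ⟷ (⟨ q ⟩ (⟨ p ⟩ φ)))) ×
      (w ⊨ ((⟨ p ⟩ ([ q ] φ)) ⟶ ([ q ] (⟨ p ⟩ φ)))) ×
      (w ⊨ ((◇ (□ φ)) ⟶ (□ (◇ φ)))) ×
      (w ⊨ ((⟨ p ⟩ (⟨ p ⟩ φ)) ⟶ (⟨ p ⟩ φ)))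
proposition1 k V σ p q φ w =
  (commutation-valid p q φ w , commutation-valid q p φ w) ,
  church-rosser-valid p q φ w ,
  confluence-valid φ w ,
  idempotence-valid p φ w
  where open Frame V σ
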